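{- Let $G$ be a graph with vertex set $\Omega$ that is a disjoint union of stars, and let $G'$ be a graph with vertex set $\Omega$. Then $\mathcal{D}(G)=\mathcal{D}(G')$ if and only if $G'$ can be obtained from $G$ as follows: choose a set $C$ consisting of exactly one center of each connected component of $G$, and add to $G$ any set of edges joining vertices of $C$.
   Context: Graphs are finite, simple, undirected; $\mathcal{D}(G)$ is the family of inclusion-minimal dominating sets of $G$ (a dominating set is $D\subseteq V(G)$ such that every vertex outside $D$ has a neighbour in $D$). A star is a tree of order $\ge2$ isomorphic to some $K_{1,m}$; its center is the vertex of degree $\ge 2$, and if the star is $K_2$ both of its vertices are considered centers. A disjoint union of stars is a graph each of whose components is a star. -}

module Defs where

open import Data.Nat using (ℕ)
open import Data.Fin using (Fin)
open import Data.Fin.Subset using (Subset; _∈_; _⊂_)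
open import Data.Bool using (Bool; true; false)
open import Data.Product using (Σ; ∃; ∃-syntax; _×_; _,_)
open import Data.Sum using (_⊎_)
open import Relation.Nullary using (¬_)
open import Relation.Binary.PropositionalEquality using (_≡_; _≢_)
open import Function.Bundles using (_⇔_)

record Graph (n : ℕ) : Set where
  field
    adj   : Fin n → Fin n → Bool
    sym   : ∀ u v → adj u v ≡ adj v u
    irrefl : ∀ v → adj v v ≡ false
open Graph public

module _ {n : ℕ} (G : Graph n) where

  Adj : Fin n → Fin n → Set
  Adj u v = adj G u v ≡ true

  data Reach : Fin n → Fin n → Set where
    here : ∀ {v} → Reach v v
    step : ∀ {u v w} → Adj u v → Reach v w → Reach u w

  Dominating : Subset n → Set
  Dominating D = ∀ v → ¬ (v ∈ D) → ∃[ u ] (u ∈ D × Adj u v)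

  MinimalDominating : Subset n → Set
  MinimalDominating D = Dominating D × (∀ D′ → D′ ⊂ D → ¬ Dominating D′)

  -- The connected component of v is a star (a tree of order ≥ 2 isomorphic
  -- to some K_{1,m}) with center c: c lies in the component, the component
  -- has another vertex, and two vertices of the component are adjacent
  -- exactly when they are distinct and one of them is c.
  StarComponentWithCenter : Fin n → Fin n → Set
  StarComponentWithCenter v c =
    Reach v c
    × (∃[ u ] (Reach v u × u ≢ c))
    × (∀ u w → Reach v u → Reach v w →
         Adj u w ⇔ (u ≢ w × (u ≡ c ⊎ w ≡ c)))

  DisjointUnionOfStars : Set
  DisjointUnionOfStars = ∀ v → ∃[ c ] StarComponentWithCenter v c

  -- c is a center of (the star which is) its connected component.
  -- (For K_2 both vertices qualify; for K_{1,m}, m ≥ 2, only the vertex of degree m.)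
  IsCenter : Fin n → Set
  IsCenter c = StarComponentWithCenter c c

SameMinimalDominatingSets : ∀ {n} → Graph n → Graph n → Set
SameMinimalDominatingSets G G′ =
  ∀ D → MinimalDominating G D ⇔ MinimalDominating G′ D

ObtainedByCenterEdges : ∀ {n} → Graph n → Graph n → Set
ObtainedByCenterEdges {n} G G′ =
  Σ (Subset n) λ C →
    (∀ c → c ∈ C → IsCenter G c)
    × (∀ v → ∃[ c ] (c ∈ C × Reach G v c))
    × (∀ c c′ → c ∈ C → c′ ∈ C → Reach G c c′ → c ≡ c′)
    × (∀ u w → Adj G u w → Adj G′ u w)
    × (∀ u w → Adj G′ u w → ¬ Adj G u w → u ∈ C × w ∈ C)

-- Two graphs have the same minimal dominating sets iff they have the same
-- dominating sets, since every dominating set contains a minimal one.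
-- Adding edges between centers, one per star, changes no dominating set: a
-- leaf of a center v is not a chosen center, so in G′ its only neighbour is
-- still v, and every dominating set of G′ contains the leaf or v.
-- Conversely, if G′ has the dominating sets of a star forest G, then for a
-- G-edge uv the set of all other vertices fails to dominate G, hence G′; so in
-- G′ one of u, v is adjacent to nothing but the other. This forces G ⊆ G′ and
-- confines the new edges to vertices having a G-neighbour of this kind, which
-- (with a tie-break inside each K₂) are exactly one center per star.
module Submission where

open import Defs
open import Data.Nat using (ℕ)
open import Function.Bundles using (_⇔_)

open import Data.Nat.Induction using (<-wellFounded)
open import Induction.WellFounded using (Acc; acc)
import Data.Nat as ℕ
open import Data.Fin using (Fin; _<_)
open import Data.Fin.Properties using (_≟_; all?; any?; ¬∀⟶∃¬; <-cmp; <-asym; _<?_)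
open import Data.Fin.Subset using (Subset; _∈_; _∉_; _⊆_; _⊂_; ∣_∣)
open import Data.Fin.Subset.Properties using (_∈?_; p⊂q⇒∣p∣<∣q∣)
open import Data.Vec using (tabulate)
open import Data.Vec.Properties using (lookup∘tabulate; []=⇒lookup; lookup⇒[]=)
open import Data.Bool using (true)
import Data.Bool.Properties as Bool
open import Data.Product using (∃-syntax; _×_; _,_; proj₁; proj₂)
open import Data.Sum using (_⊎_; inj₁; inj₂; [_,_]′; swap)
open import Data.Empty using (⊥-elim)
open import Relation.Nullary using (¬_; Dec; yes; no; does)
open import Relation.Nullary.Decidable using (dec-true; _×-dec_; _→-dec_; ¬?)
open import Relation.Unary using (Decidable)
open import Relation.Binary.PropositionalEquality as ≡ using (_≡_; _≢_; refl; trans; subst)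
open import Relation.Binary.Definitions using (tri<; tri≈; tri>)
open import Function using (_∘_; id)
open import Function.Bundles using (mk⇔; module Equivalence)
open Equivalence using (to; from)

module _ {n : ℕ} {P : Fin n → Set} (P? : Decidable P) where

  subsetOf : Subset n
  subsetOf = tabulate (does ∘ P?)

  ∈subsetOf⁺ : ∀ {x} → P x → x ∈ subsetOf
  ∈subsetOf⁺ {x} px =
    lookup⇒[]= x subsetOf (trans (lookup∘tabulate (does ∘ P?) x) (dec-true (P? x) px))

  ∈subsetOf⁻ : ∀ {x} → x ∈ subsetOf → P x
  ∈subsetOf⁻ {x} x∈ with P? x | trans (≡.sym (lookup∘tabulate (does ∘ P?) x)) ([]=⇒lookup x∈)
  ... | yes px | _ = px

module _ {n : ℕ} where

  removed? : ∀ (D : Subset n) x → Decidable (λ z → z ∈ D × z ≢ x)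
  removed? D x z = (z ∈? D) ×-dec ¬? (z ≟ x)

  _∖_ : Subset n → Fin n → Subset n
  D ∖ x = subsetOf (removed? D x)

  ∈∖⁺ : ∀ (D : Subset n) x {z} → z ∈ D → z ≢ x → z ∈ D ∖ x
  ∈∖⁺ D x z∈D z≢x = ∈subsetOf⁺ (removed? D x) (z∈D , z≢x)

  ∈∖⁻ : ∀ (D : Subset n) x {z} → z ∈ D ∖ x → z ∈ D × z ≢ x
  ∈∖⁻ D x = ∈subsetOf⁻ (removed? D x)

  ∖-⊂ : ∀ {D x} → x ∈ D → D ∖ x ⊂ D
  ∖-⊂ {D} {x} x∈D = proj₁ ∘ ∈∖⁻ D x , x , x∈D , λ x∈ → proj₂ (∈∖⁻ D x x∈) refl

  ≢? : (x : Fin n) → Decidable (_≢ x)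
  ≢? x z = ¬? (z ≟ x)

  allBut : Fin n → Subset n
  allBut x = subsetOf (≢? x)

  ∈allBut⁺ : ∀ {x z} → z ≢ x → z ∈ allBut x
  ∈allBut⁺ {x} = ∈subsetOf⁺ (≢? x)

  ∉allBut : ∀ {x} → x ∉ allBut x
  ∉allBut {x} x∈ = ∈subsetOf⁻ (≢? x) x∈ refl

  ≢₂? : (u v : Fin n) → Decidable (λ z → z ≢ u × z ≢ v)
  ≢₂? u v z = ≢? u z ×-dec ≢? v z

  allBut₂ : Fin n → Fin n → Subset n
  allBut₂ u v = subsetOf (≢₂? u v)

  ∉allBut₂ˡ : (u v : Fin n) → u ∉ allBut₂ u v
  ∉allBut₂ˡ u v u∈ = proj₁ (∈subsetOf⁻ (≢₂? u v) u∈) refl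

  ∉allBut₂ʳ : (u v : Fin n) → v ∉ allBut₂ u v
  ∉allBut₂ʳ u v v∈ = proj₂ (∈subsetOf⁻ (≢₂? u v) v∈) refl

  ∉allBut₂ : (u v : Fin n) {z : Fin n} → z ∉ allBut₂ u v → z ≡ u ⊎ z ≡ v
  ∉allBut₂ u v {z} z∉ with z ≟ u | z ≟ v
  ... | yes z≡u | _       = inj₁ z≡u
  ... | no _    | yes z≡v = inj₂ z≡v
  ... | no z≢u  | no z≢v  = ⊥-elim (z∉ (∈subsetOf⁺ (≢₂? u v) (z≢u , z≢v)))

module _ {n : ℕ} (H : Graph n) where

  Adj? : ∀ u v → Dec (Adj H u v)
  Adj? u v = adj H u v Bool.≟ true

  adj-sym : ∀ {u v} → Adj H u v → Adj H v u
  adj-sym {u} {v} = trans (Graph.sym H v u)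

  adj⇒≢ : ∀ {u v} → Adj H u v → u ≢ v
  adj⇒≢ {u} a refl with trans (≡.sym a) (irrefl H u)
  ... | ()

  reach-snoc : ∀ {u v w} → Reach H u v → Adj H v w → Reach H u w
  reach-snoc here        a = step a here
  reach-snoc (step b r)  a = step b (reach-snoc r a)

  -- Unlike a pendant vertex in the usual sense, y may be isolated.
  Pendant : Fin n → Fin n → Set
  Pendant y x = ∀ z → Adj H y z → z ≡ x

  Pendant? : ∀ y x → Dec (Pendant y x)
  Pendant? y x = all? λ z → Adj? y z →-dec (z ≟ x)

  pendant-adj : ∀ {y x z} → Pendant y x → Adj H y z → Adj H y x
  pendant-adj {y} p a = subst (Adj H y) (p _ a) a

  dominated? : ∀ D v → Dec (v ∉ D → ∃[ u ] (u ∈ D × Adj H u v))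
  dominated? D v = ¬? (v ∈? D) →-dec any? λ u → (u ∈? D) ×-dec Adj? u v

  Dominating? : ∀ D → Dec (Dominating H D)
  Dominating? D = all? (dominated? D)

  dominating-⊆ : ∀ {D E} → D ⊆ E → Dominating H D → Dominating H E
  dominating-⊆ D⊆E dom v v∉E with dom v (v∉E ∘ D⊆E)
  ... | u , u∈D , a = u , D⊆E u∈D , a

  ¬dominating⇒undominated : ∀ {D} → ¬ Dominating H D →
    ∃[ v ] (v ∉ D × (∀ u → Adj H v u → u ∉ D))
  ¬dominating⇒undominated {D} ¬dom with ¬∀⟶∃¬ n _ (dominated? D) ¬dom
  ... | v , ¬dom-v =
    v , (λ v∈D → ¬dom-v (λ v∉D → ⊥-elim (v∉D v∈D))) ,
    (λ u a u∈D → ¬dom-v (λ _ → u , u∈D , adj-sym a))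

  pendant⇒¬dominating : ∀ {D y x} → Pendant y x → y ∉ D → x ∉ D → ¬ Dominating H D
  pendant⇒¬dominating p y∉D x∉D dom with dom _ y∉D
  ... | u , u∈D , a = x∉D (subst (_∈ _) (p u (adj-sym a)) u∈D)

  minimal-dominating-⊆ : ∀ D → Dominating H D → ∃[ M ] (M ⊆ D × MinimalDominating H M)
  minimal-dominating-⊆ D = go D (<-wellFounded ∣ D ∣)
    where
    go : ∀ D → Acc ℕ._<_ ∣ D ∣ → Dominating H D → ∃[ M ] (M ⊆ D × MinimalDominating H M)
    go D (acc rec) dom with any? (λ x → (x ∈? D) ×-dec Dominating? (D ∖ x))
    ... | yes (x , x∈D , dom∖x) with go (D ∖ x) (rec (p⊂q⇒∣p∣<∣q∣ (∖-⊂ x∈D))) dom∖x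
    ...   | M , M⊆ , min = M , proj₁ ∘ ∈∖⁻ D x ∘ M⊆ , min
    go D _ dom | no irreducible = D , id , dom , λ where
      D′ (D′⊆D , x , x∈D , x∉D′) dom′ → irreducible (x , x∈D ,
        dominating-⊆ (λ z∈D′ → ∈∖⁺ D x (D′⊆D z∈D′) λ { refl → x∉D′ z∈D′ }) dom′)

  has-neighbour⇔dominating-allBut : ∀ x → (∃[ y ] Adj H x y) ⇔ Dominating H (allBut x)
  has-neighbour⇔dominating-allBut x = mk⇔ neighbour⇒dom dom⇒neighbour
    where
    neighbour⇒dom : ∃[ y ] Adj H x y → Dominating H (allBut x)
    neighbour⇒dom (y , a) v v∉ with v ≟ x
    ... | yes refl = y , ∈allBut⁺ (adj⇒≢ (adj-sym a)) , adj-sym a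
    ... | no v≢x = ⊥-elim (v∉ (∈allBut⁺ v≢x))

    dom⇒neighbour : Dominating H (allBut x) → ∃[ y ] Adj H x y
    dom⇒neighbour dom with dom x ∉allBut
    ... | y , _ , a = y , adj-sym a

  ¬dominating-allBut₂⇔pendant : ∀ u v →
    (¬ Dominating H (allBut₂ u v)) ⇔ (Pendant u v ⊎ Pendant v u)
  ¬dominating-allBut₂⇔pendant u v = mk⇔ ¬dominating⇒pendant pendant⇒¬dominating-allBut₂
    where
    pendant⇒¬dominating-allBut₂ : Pendant u v ⊎ Pendant v u → ¬ Dominating H (allBut₂ u v)
    pendant⇒¬dominating-allBut₂ (inj₁ p) = pendant⇒¬dominating p (∉allBut₂ˡ u v) (∉allBut₂ʳ u v)
    pendant⇒¬dominating-allBut₂ (inj₂ p) = pendant⇒¬dominating p (∉allBut₂ʳ u v) (∉allBut₂ˡ u v)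

    ¬dominating⇒pendant : ¬ Dominating H (allBut₂ u v) → Pendant u v ⊎ Pendant v u
    ¬dominating⇒pendant ¬dom with ¬dominating⇒undominated ¬dom
    ... | w , w∉ , isolated with ∉allBut₂ u v w∉
    ...   | inj₁ refl = inj₁ λ z a →
      [ (λ z≡w → ⊥-elim (adj⇒≢ a (≡.sym z≡w))) , id ]′ (∉allBut₂ u v (isolated z a))
    ...   | inj₂ refl = inj₂ λ z a →
      [ id , (λ z≡w → ⊥-elim (adj⇒≢ a (≡.sym z≡w))) ]′ (∉allBut₂ u v (isolated z a))

SameDominatingSets : ∀ {n} → Graph n → Graph n → Set
SameDominatingSets G G′ = ∀ D → Dominating G D ⇔ Dominating G′ D

minimal⇒dominating-transfer : ∀ {n} {G G′ : Graph n} →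
  (∀ M → MinimalDominating G M → MinimalDominating G′ M) →
  ∀ D → Dominating G D → Dominating G′ D
minimal⇒dominating-transfer {G = G} {G′} min-transfer D dom with minimal-dominating-⊆ G D dom
... | M , M⊆D , min = dominating-⊆ G′ M⊆D (proj₁ (min-transfer M min))

dominating⇒minimal-transfer : ∀ {n} {G G′ : Graph n} →
  (∀ D → Dominating G D → Dominating G′ D) →
  (∀ D → Dominating G′ D → Dominating G D) →
  ∀ M → MinimalDominating G M → MinimalDominating G′ M
dominating⇒minimal-transfer forth back M (dom , min) =
  forth M dom , λ D D⊂M dom′ → min D D⊂M (back D dom′)

sameMinimalDominating⇔sameDominating : ∀ {n} (G G′ : Graph n) →
  SameMinimalDominatingSets G G′ ⇔ SameDominatingSets G G′
sameMinimalDominating⇔sameDominating G G′ = mk⇔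
  (λ same D → mk⇔ (minimal⇒dominating-transfer {G = G} {G′} (λ M → to (same M)) D)
                  (minimal⇒dominating-transfer {G = G′} {G} (λ M → from (same M)) D))
  (λ same M → mk⇔
    (dominating⇒minimal-transfer {G = G} {G′} (λ D → to (same D)) (λ D → from (same D)) M)
    (dominating⇒minimal-transfer {G = G′} {G} (λ D → from (same D)) (λ D → to (same D)) M))

dominating-⊆-supergraph : ∀ {n} {G G′ : Graph n} → (∀ u v → Adj G u v → Adj G′ u v) →
  ∀ D → Dominating G D → Dominating G′ D
dominating-⊆-supergraph G⊆G′ D dom v v∉D with dom v v∉D
... | u , u∈D , a = u , u∈D , G⊆G′ u v a

module _ {n : ℕ} {G : Graph n} {v c : Fin n} (S : StarComponentWithCenter G v c) where

  private
    adj⇔ : ∀ u w → Reach G v u → Reach G v w → Adj G u w ⇔ (u ≢ w × (u ≡ c ⊎ w ≡ c))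
    adj⇔ = proj₂ (proj₂ S)

  star-leaf-adj : ∀ {x} → Reach G v x → x ≢ c → Adj G x c
  star-leaf-adj {x} rx x≢c = from (adj⇔ x c rx (proj₁ S)) (x≢c , inj₂ refl)

  star-leaf-pendant : ∀ {x} → Reach G v x → x ≢ c → Pendant G x c
  star-leaf-pendant {x} rx x≢c z a with to (adj⇔ x z rx (reach-snoc G rx a)) a
  ... | _ , inj₁ x≡c = ⊥-elim (x≢c x≡c)
  ... | _ , inj₂ z≡c = z≡c

  -- A center whose only neighbour is c′ lies in a copy of K₂, of which c′ is a center too.
  star-recenter : ∀ {c′} → Reach G v c′ → c′ ≢ c → Pendant G c c′ →
    StarComponentWithCenter G v c′
  star-recenter {c′} rc′ c′≢c p = rc′ , (c , proj₁ S , c′≢c ∘ ≡.sym) , adj⇔′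
    where
    edge : Adj G c′ c
    edge = star-leaf-adj rc′ c′≢c

    ends : ∀ {u} → Reach G v u → u ≡ c′ ⊎ u ≡ c
    ends {u} ru with u ≟ c
    ... | yes u≡c = inj₂ u≡c
    ... | no u≢c  = inj₁ (p u (adj-sym G (star-leaf-adj ru u≢c)))

    no-loop : ∀ {u} {A : Set} → Adj G u u ⇔ (u ≢ u × A)
    no-loop = mk⇔ (λ a → ⊥-elim (adj⇒≢ G a refl)) (λ (u≢u , _) → ⊥-elim (u≢u refl))

    adj⇔′ : ∀ u w → Reach G v u → Reach G v w → Adj G u w ⇔ (u ≢ w × (u ≡ c′ ⊎ w ≡ c′))
    adj⇔′ u w ru rw with ends ru | ends rw
    ... | inj₁ refl | inj₁ refl = no-loop
    ... | inj₁ refl | inj₂ refl = mk⇔ (λ _ → c′≢c , inj₁ refl) (λ _ → edge)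
    ... | inj₂ refl | inj₁ refl = mk⇔ (λ _ → c′≢c ∘ ≡.sym , inj₂ refl) (λ _ → adj-sym G edge)
    ... | inj₂ refl | inj₂ refl = no-loop

module _ {n : ℕ} {G : Graph n} (stars : DisjointUnionOfStars G) where

  star-edge-pendant : ∀ {u v} → Adj G u v → Pendant G u v ⊎ Pendant G v u
  star-edge-pendant {u} {v} a with stars u
  ... | c , S with u ≟ c
  ... | yes refl = inj₂ (star-leaf-pendant S (step a here) (adj⇒≢ G (adj-sym G a)))
  ... | no u≢c   = inj₁ λ z a′ →
    trans (star-leaf-pendant S here u≢c z a′) (≡.sym (star-leaf-pendant S here u≢c v a))

  star-has-neighbour : ∀ v → ∃[ y ] Adj G v y
  star-has-neighbour v with stars v
  ... | c , S@(_ , (o , ro , o≢c) , _) with v ≟ c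
  ... | yes refl = o , adj-sym G (star-leaf-adj S ro o≢c)
  ... | no v≢c   = c , star-leaf-adj S here v≢c

centerEdges⇒sameDominating : ∀ {n} (G G′ : Graph n) →
  ObtainedByCenterEdges G G′ → SameDominatingSets G G′
centerEdges⇒sameDominating G G′ (C , central , _ , unique , G⊆G′ , new⇒central) D =
  mk⇔ (dominating-⊆-supergraph {G = G} {G′} G⊆G′ D) G′-dominating⇒G-dominating
  where
  central-dominated : Dominating G′ D → ∀ {v} → v ∈ C → v ∉ D → ∃[ u ] (u ∈ D × Adj G u v)
  central-dominated dom {v} v∈C v∉D with central v v∈C
  ... | S@(_ , (l , rl , l≢v) , _) with l ∈? D
  ... | yes l∈D = l , l∈D , star-leaf-adj S rl l≢v
  ... | no l∉D with dom l l∉D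
  ...   | x , x∈D , a′ with Adj? G x l
  ...     | yes a = ⊥-elim (v∉D (subst (_∈ D) (star-leaf-pendant S rl l≢v x (adj-sym G a)) x∈D))
  ...     | no ¬a = ⊥-elim (l≢v (≡.sym (unique v l v∈C (proj₂ (new⇒central x l a′ ¬a)) rl)))

  G′-dominating⇒G-dominating : Dominating G′ D → Dominating G D
  G′-dominating⇒G-dominating dom v v∉D with dom v v∉D
  ... | u , u∈D , a′ with Adj? G u v
  ...   | yes a = u , u∈D , a
  ...   | no ¬a = central-dominated dom (proj₂ (new⇒central u v a′ ¬a)) v∉D

module CenterEdges {n : ℕ} {G G′ : Graph n}
  (stars : DisjointUnionOfStars G) (same : SameDominatingSets G G′) where

  has-neighbour′ : ∀ x → ∃[ y ] Adj G′ x y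
  has-neighbour′ x = from (has-neighbour⇔dominating-allBut G′ x)
    (to (same (allBut x)) (to (has-neighbour⇔dominating-allBut G x) (star-has-neighbour stars x)))

  edge-pendant′ : ∀ {u v} → Adj G u v → Pendant G′ u v ⊎ Pendant G′ v u
  edge-pendant′ {u} {v} a = to (¬dominating-allBut₂⇔pendant G′ u v) λ dom′ →
    from (¬dominating-allBut₂⇔pendant G u v) (star-edge-pendant stars a)
      (from (same (allBut₂ u v)) dom′)

  G⊆G′ : ∀ {u v} → Adj G u v → Adj G′ u v
  G⊆G′ {u} {v} a with edge-pendant′ a
  ... | inj₁ p = pendant-adj G′ p (proj₂ (has-neighbour′ u))
  ... | inj₂ p = adj-sym G′ (pendant-adj G′ p (proj₂ (has-neighbour′ v)))

  pendant′⇒pendant : ∀ {y x} → Pendant G′ y x → Pendant G y x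
  pendant′⇒pendant p z = p z ∘ G⊆G′

  -- In a K₂ component both ends may be G′-pendant at each other; the condition
  -- x < y then picks one of them.
  Chosen : Fin n → Set
  Chosen x = ∃[ y ] (Adj G x y × Pendant G′ y x × (Pendant G′ x y → x < y))

  Chosen? : Decidable Chosen
  Chosen? x = any? λ y → Adj? G x y ×-dec Pendant? G′ y x ×-dec (Pendant? G′ x y →-dec x <? y)

  pendant′⇒chosen : ∀ {x y} → Adj G x y → Pendant G′ y x → Chosen x ⊎ Chosen y
  pendant′⇒chosen {x} {y} a p with Pendant? G′ x y
  ... | no ¬p′ = inj₁ (y , a , p , ⊥-elim ∘ ¬p′)
  ... | yes p′ with <-cmp x y
  ...   | tri< x<y _ _ = inj₁ (y , a , p , λ _ → x<y)
  ...   | tri≈ _ x≡y _ = ⊥-elim (adj⇒≢ G a x≡y)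
  ...   | tri> _ _ y<x = inj₂ (x , adj-sym G a , p′ , λ _ → y<x)

  edge-chosen : ∀ {x y} → Adj G x y → Chosen x ⊎ Chosen y
  edge-chosen a with edge-pendant′ a
  ... | inj₁ p = swap (pendant′⇒chosen (adj-sym G a) p)
  ... | inj₂ p = pendant′⇒chosen a p

  new-edge-chosen : ∀ {u w} → Adj G′ u w → ¬ Adj G u w → Chosen u
  new-edge-chosen {u} {w} a′ ¬a with star-has-neighbour stars u
  ... | y , a = [ ⊥-elim ∘ ¬pendant , (λ p → y , a , p , ⊥-elim ∘ ¬pendant) ]′ (edge-pendant′ a)
    where
    ¬pendant : ¬ Pendant G′ u y
    ¬pendant p = ¬a (subst (Adj G u) (≡.sym (p w a′)) a)

  chosen-pendant′ : ∀ {c c′} → Chosen c → Pendant G′ c c′ → Pendant G′ c′ c × c < c′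
  chosen-pendant′ (y , a , p , tiebreak) pc with pc y (G⊆G′ a)
  ... | refl = p , tiebreak pc

  chosen-¬pendant′ : ∀ {c c′} → Chosen c → Chosen c′ → ¬ Pendant G′ c c′
  chosen-¬pendant′ ch ch′ pc with chosen-pendant′ ch pc
  ... | pc′ , c<c′ = <-asym c<c′ (proj₂ (chosen-pendant′ ch′ pc′))

  chosen-off-center : ∀ {v c₀ x} → StarComponentWithCenter G v c₀ → Reach G v x → x ≢ c₀ →
    Chosen x → Pendant G′ c₀ x
  chosen-off-center {x = x} S rx x≢c₀ (y , a , p , _) =
    subst (λ t → Pendant G′ t x) (star-leaf-pendant S rx x≢c₀ y a) p

  chosen⇒center : ∀ {c} → Chosen c → IsCenter G c
  chosen⇒center {c} ch with stars c
  ... | c₀ , S with c ≟ c₀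
  ... | yes refl = S
  ... | no c≢c₀  = star-recenter S here c≢c₀ (pendant′⇒pendant (chosen-off-center S here c≢c₀ ch))

  chosen-unique : ∀ {c c′} → Chosen c → Chosen c′ → Reach G c c′ → c ≡ c′
  chosen-unique {c} {c′} ch ch′ rc′ with stars c
  ... | c₀ , S with c ≟ c₀ | c′ ≟ c₀
  ... | yes refl | yes refl = refl
  ... | yes refl | no c′≢c₀ = ⊥-elim (chosen-¬pendant′ ch ch′ (chosen-off-center S rc′ c′≢c₀ ch′))
  ... | no c≢c₀  | yes refl = ⊥-elim (chosen-¬pendant′ ch′ ch (chosen-off-center S here c≢c₀ ch))
  ... | no c≢c₀  | no c′≢c₀ = ≡.sym (chosen-off-center S here c≢c₀ ch c′
                                      (G⊆G′ (adj-sym G (star-leaf-adj S rc′ c′≢c₀))))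

  centerEdges : ObtainedByCenterEdges G G′
  centerEdges =
    C , (λ c → chosen⇒center ∘ ∈C⁻) , covered ,
    (λ c c′ c∈C c′∈C → chosen-unique (∈C⁻ c∈C) (∈C⁻ c′∈C)) , (λ _ _ → G⊆G′) ,
    λ u w a′ ¬a → ∈C⁺ (new-edge-chosen a′ ¬a) , ∈C⁺ (new-edge-chosen (adj-sym G′ a′) (¬a ∘ adj-sym G))
    where
    C : Subset n
    C = subsetOf Chosen?

    ∈C⁺ : ∀ {c} → Chosen c → c ∈ C
    ∈C⁺ = ∈subsetOf⁺ Chosen?

    ∈C⁻ : ∀ {c} → c ∈ C → Chosen c
    ∈C⁻ = ∈subsetOf⁻ Chosen?

    covered : ∀ v → ∃[ c ] (c ∈ C × Reach G v c)
    covered v with star-has-neighbour stars v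
    ... | y , a = [ (λ ch → v , ∈C⁺ ch , here) , (λ ch → y , ∈C⁺ ch , step a here) ]′ (edge-chosen a)

proposition4p9 : (n : ℕ) (G G′ : Graph n) → DisjointUnionOfStars G →
    SameMinimalDominatingSets G G′ ⇔ ObtainedByCenterEdges G G′
proposition4p9 n G G′ stars = mk⇔
  (CenterEdges.centerEdges {G′ = G′} stars ∘ to (sameMinimalDominating⇔sameDominating G G′))
  (from (sameMinimalDominating⇔sameDominating G G′) ∘ centerEdges⇒sameDominating G G′)
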